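{- For 2 players and 2 cakes, each cake cut into 2 pieces, there exist preferences for the two players, satisfying the assumptions described in the context, such that for no division $x$ are there disjoint piece selections $s_A\in\mathrm{Pref}_A(x)$ and $s_B\in\mathrm{Pref}_B(x)$. That is, a division with disjoint envy-free piece selections need not exist.
   Context: Model of multi-cake division. There are $m$ cakes, each of length $1$, and cake $i$ is cut into $k$ pieces (here $m=k=2$). A division is an $m\times k$ matrix $x=(x_{ij})$ with $x_{ij}\ge 0$ and $\sum_{j} x_{ij}=1$ for every $i$; $x_{ij}$ is the length of the $j$-th piece of cake $i$. A piece selection is a choice of one piece from each cake, i.e. a map $s:\{1,\dots,m\}\to\{1,\dots,k\}$. Two piece selections $s,s'$ are disjoint if $s(i)\ne s'(i)$ for every cake $i$. Each player (here $A$ and $B$) has preferences given by assigning to every division $x$ a nonempty set $\mathrm{Pref}(x)$ of preferred piece selections (those the player considers not worse than any other at $x$); preferences of a player depend only on that player. Assumptions: (hungry) a player prefers a nonempty piece in a cake to an empty one in that cake with the other cakes' pieces fixed, so no $s\in\mathrm{Pref}(x)$ contains an empty piece ($x_{i,s(i)}>0$ for all $i$); (closed) for each piece selection $s$ the set of divisions $x$ with $s\in\mathrm{Pref}(x)$ is closed. Envy-free piece selections at $x$ for the players are selections $s_A\in\mathrm{Pref}_A(x)$, $s_B\in\mathrm{Pref}_B(x)$. -}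

module Defs where

open import Data.Fin using (Fin; zero; suc)
open import Data.Product using (Σ; ∃; ∃-syntax; _×_)
open import Relation.Nullary using (¬_)
open import Relation.Binary.PropositionalEquality using (_≡_; _≢_)
open import Relation.Binary.Structures using (IsTotalOrder)
open import Algebra.Structures using (IsCommutativeRing)

-- The real numbers, axiomatised as a complete ordered field.
-- (agda-stdlib has no reals; every model of this record is, classically,
-- isomorphic to ℝ, so quantifying over all models states the claim for ℝ.)

record RealField : Set₁ where
  infixl 6 _+_ _-_
  infixl 7 _*_
  infix 4 _≤_ _<_
  field
    Carrier : Set
    _+_ _*_ : Carrier → Carrier → Carrier
    -_      : Carrier → Carrier
    0# 1#   : Carrier
    _≤_     : Carrier → Carrier → Set
    isCommutativeRing : IsCommutativeRing _≡_ _+_ _*_ -_ 0# 1#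
    0≢1     : 0# ≢ 1#
    inverse : ∀ a → a ≢ 0# → ∃[ b ] (a * b ≡ 1#)
    isTotalOrder : IsTotalOrder _≡_ _≤_
    +-mono-≤ : ∀ {a b} c → a ≤ b → a + c ≤ b + c
    *-nonneg : ∀ {a b} → 0# ≤ a → 0# ≤ b → 0# ≤ a * b
    sup : (P : Carrier → Set) → ∃[ a ] P a → ∃[ u ] (∀ a → P a → a ≤ u) →
          ∃[ s ] ((∀ a → P a → a ≤ s) × (∀ u → (∀ a → P a → a ≤ u) → s ≤ u))

  _<_ : Carrier → Carrier → Set
  a < b = (a ≤ b) × (a ≢ b)

  _-_ : Carrier → Carrier → Carrier
  a - b = a + (- b)

  dist< : Carrier → Carrier → Carrier → Set
  dist< a b ε = (a - b < ε) × (b - a < ε)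

module _ (R : RealField) where
  open RealField R

  -- an m×k matrix (m = k = 2): x i j = length of piece j of cake i
  Matrix : Set
  Matrix = Fin 2 → Fin 2 → Carrier

  IsDivision : Matrix → Set
  IsDivision x = (∀ i j → 0# ≤ x i j) × (∀ i → x i zero + x i (suc zero) ≡ 1#)

  Selection : Set
  Selection = Fin 2 → Fin 2

  Disjoint : Selection → Selection → Set
  Disjoint s s' = ∀ i → s i ≢ s' i

  -- { x ∈ divisions | P x } is closed (its complement in the set of
  -- divisions is open, w.r.t. the entrywise distance)
  IsClosedSet : (Matrix → Set) → Set
  IsClosedSet P = ∀ x → IsDivision x → ¬ P x →
    ∃[ ε ] (0# < ε × (∀ y → IsDivision y → (∀ i j → dist< (y i j) (x i j) ε) → ¬ P y))

  record Preferences : Set₁ where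
    field
      Pref     : Matrix → Selection → Set
      nonempty : ∀ x → IsDivision x → ∃[ s ] Pref x s
      hungry   : ∀ x → IsDivision x → ∀ s → Pref x s → ∀ i → 0# < x i (s i)
      closed   : ∀ s → IsClosedSet (λ x → Pref x s)

-- Each player takes the larger piece of one cake and then chooses in the other cake after
-- crediting the leftover of the first cake to one of the pieces there.  Player A credits the
-- leftover of cake a to the piece of cake b whose index is that of A's own piece of cake a;
-- player B credits the leftover of cake b to the piece of cake a whose index is that of the
-- leftover.  Each preferred selection is cut out by two non-strict linear inequalities, so the
-- preferences are closed, and totality of the order makes some selection preferred.  For
-- disjoint selections the two crediting rules clash: two of the four inequalities force a
-- piece of one cake to be empty, and then the others force the smaller piece of the other cake
-- to have length at least 1.  The same estimates show that both players are hungry.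

module Submission where

open import Defs
open import Data.Nat using (ℕ; zero; suc) renaming (_+_ to _+ℕ_)
open import Data.Fin using (Fin; opposite)
open import Data.Fin.Patterns using (0F; 1F)
open import Data.Fin.Properties using (∀-cons)
open import Data.Product using (∃-syntax; _×_; _,_; proj₁; proj₂)
open import Data.Sum using (inj₁; inj₂)
open import Data.Empty using (⊥-elim)
open import Data.Vec.Functional using ([]; _∷_)
open import Relation.Nullary using (¬_)
open import Relation.Binary.PropositionalEquality
  using (_≡_; _≢_; refl; sym; trans; cong; subst; subst₂)
open import Relation.Binary.Bundles using (Poset)
open import Relation.Binary.Structures using (IsTotalOrder)
open import Algebra.Bundles using (CommutativeRing)
open import Algebra.Structures using (IsCommutativeRing)

module RealFieldProperties (R : RealField) where

  open RealField R renaming (+-mono-≤ to +-monoˡ-≤)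
  open IsCommutativeRing isCommutativeRing
    using (+-comm; +-identityˡ; +-identityʳ; -‿inverseʳ; *-identityˡ; *-assoc; zeroʳ)
  open IsTotalOrder isTotalOrder public
    using (total; antisym) renaming (refl to ≤-refl; trans to ≤-trans; reflexive to ≤-reflexive)

  commutativeRing : CommutativeRing _ _
  commutativeRing = record { isCommutativeRing = isCommutativeRing }

  open import Algebra.Properties.Ring (CommutativeRing.ring commutativeRing)
    using (-1*x≈-x; -‿involutive; -‿distribʳ-*; //-rightDividesˡ; //-rightDividesʳ; x∙y⁻¹≈ε⇒x≈y)
  open import Algebra.Properties.Semiring.Mult (CommutativeRing.semiring commutativeRing) public
    using (×-homo-+; ×-assoc-*) renaming (_×_ to _·_)

  ≤-poset : Poset _ _ _
  ≤-poset = record { isPartialOrder = IsTotalOrder.isPartialOrder isTotalOrder }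

  open import Relation.Binary.Reasoning.PartialOrder ≤-poset

  +-monoʳ-≤ : ∀ c {a b} → a ≤ b → c + a ≤ c + b
  +-monoʳ-≤ c {a} {b} a≤b = begin
    c + a ≡⟨ +-comm c a ⟩
    a + c ≤⟨ +-monoˡ-≤ c a≤b ⟩
    b + c ≡⟨ +-comm b c ⟩
    c + b ∎

  +-mono-≤ : ∀ {a b c d} → a ≤ b → c ≤ d → a + c ≤ b + d
  +-mono-≤ {b = b} {c} a≤b c≤d = ≤-trans (+-monoˡ-≤ c a≤b) (+-monoʳ-≤ b c≤d)

  +-cancelʳ-≤ : ∀ c {a b} → a + c ≤ b + c → a ≤ b
  +-cancelʳ-≤ c {a} {b} h = begin
    a           ≡⟨ sym (//-rightDividesʳ c a) ⟩
    (a + c) - c ≤⟨ +-monoˡ-≤ (- c) h ⟩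
    (b + c) - c ≡⟨ //-rightDividesʳ c b ⟩
    b           ∎

  +-cancelˡ-≤ : ∀ c {a b} → c + a ≤ c + b → a ≤ b
  +-cancelˡ-≤ c {a} {b} h = +-cancelʳ-≤ c (subst₂ _≤_ (+-comm c a) (+-comm c b) h)

  +-reflect-≤ : ∀ {a a′ b b′} → b ≤ a → b′ ≤ a′ → a + a′ ≤ b + b′ → a ≤ b × a′ ≤ b′
  +-reflect-≤ {a} {a′} {b} {b′} b≤a b′≤a′ a+a′≤b+b′ =
    +-cancelʳ-≤ b′ (≤-trans (+-monoʳ-≤ a b′≤a′) a+a′≤b+b′) ,
    +-cancelˡ-≤ b (≤-trans (+-monoˡ-≤ a′ b≤a) a+a′≤b+b′)

  x≤x+y : ∀ {x y} → 0# ≤ y → x ≤ x + y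
  x≤x+y {x} {y} 0≤y = begin
    x      ≡⟨ sym (+-identityʳ x) ⟩
    x + 0# ≤⟨ +-monoʳ-≤ x 0≤y ⟩
    x + y  ∎

  x+y≤z≤x⇒y≤0 : ∀ {x y z} → x + y ≤ z → z ≤ x → y ≤ 0#
  x+y≤z≤x⇒y≤0 {x} h z≤x = +-cancelˡ-≤ x (≤-trans (≤-trans h z≤x) (≤-reflexive (sym (+-identityʳ x))))

  x≤0⇒0≤-x : ∀ {x} → x ≤ 0# → 0# ≤ - x
  x≤0⇒0≤-x {x} x≤0 = begin
    0#     ≡⟨ sym (-‿inverseʳ x) ⟩
    x - x  ≤⟨ +-monoˡ-≤ (- x) x≤0 ⟩
    0# - x ≡⟨ +-identityˡ (- x) ⟩
    - x    ∎

  0≤-x⇒x≤0 : ∀ {x} → 0# ≤ - x → x ≤ 0#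
  0≤-x⇒x≤0 {x} 0≤-x = begin
    x       ≡⟨ sym (+-identityˡ x) ⟩
    0# + x  ≤⟨ +-monoˡ-≤ x 0≤-x ⟩
    - x + x ≡⟨ +-comm (- x) x ⟩
    x - x   ≡⟨ -‿inverseʳ x ⟩
    0#      ∎

  sub-≤ : ∀ {a b c} → a - b ≤ c → a ≤ b + c
  sub-≤ {a} {b} {c} a-b≤c = begin
    a           ≡⟨ sym (//-rightDividesˡ b a) ⟩
    (a - b) + b ≤⟨ +-monoˡ-≤ b a-b≤c ⟩
    c + b       ≡⟨ +-comm c b ⟩
    b + c       ∎

  0≤1 : 0# ≤ 1#
  0≤1 with total 0# 1#
  ... | inj₁ 0≤1 = 0≤1
  ... | inj₂ 1≤0 = subst (0# ≤_) -1*-1≡1 (*-nonneg (x≤0⇒0≤-x 1≤0) (x≤0⇒0≤-x 1≤0))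
    where
    -1*-1≡1 : - 1# * - 1# ≡ 1#
    -1*-1≡1 = trans (-1*x≈-x (- 1#)) (-‿involutive 1#)

  1≰0 : ¬ 1# ≤ 0#
  1≰0 1≤0 = 0≢1 (antisym 0≤1 1≤0)

  1+1≰1 : ¬ 1# + 1# ≤ 1#
  1+1≰1 h = 1≰0 (+-cancelʳ-≤ 1# (≤-trans h (≤-reflexive (sym (+-identityˡ 1#)))))

  major-pos : ∀ {p p′} → p + p′ ≡ 1# → p′ ≤ p → ¬ p ≤ 0#
  major-pos {p} {p′} p+p′≡1 p′≤p p≤0 = 1≰0 (begin
    1#      ≡⟨ sym p+p′≡1 ⟩
    p + p′  ≤⟨ +-mono-≤ p≤0 (≤-trans p′≤p p≤0) ⟩
    0# + 0# ≡⟨ +-identityʳ 0# ⟩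
    0#      ∎)

  dominant-pos : ∀ {p p′ c} → p + p′ ≡ 1# → 0# ≤ c → p′ + c ≤ p → ¬ p ≤ 0#
  dominant-pos p+p′≡1 0≤c p′+c≤p = major-pos p+p′≡1 (≤-trans (x≤x+y 0≤c) p′+c≤p)

  boosted-pos : ∀ {p p′ q q′} → p + p′ ≡ 1# → q + q′ ≡ 1# → p′ ≤ p → q′ ≤ q + p′ → ¬ q ≤ 0#
  boosted-pos {p} {p′} {q} {q′} p+p′≡1 q+q′≡1 p′≤p q′≤q+p′ q≤0 = 1+1≰1 (begin
    1# + 1# ≤⟨ +-mono-≤ (≤-trans 1≤p′ p′≤p) 1≤p′ ⟩
    p + p′  ≡⟨ p+p′≡1 ⟩
    1#      ∎)
    where
    1≤p′ : 1# ≤ p′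
    1≤p′ = begin
      1#             ≡⟨ sym q+q′≡1 ⟩
      q + q′         ≤⟨ +-mono-≤ q≤0 (≤-trans q′≤q+p′ (+-monoˡ-≤ p′ q≤0)) ⟩
      0# + (0# + p′) ≡⟨ trans (+-identityˡ _) (+-identityˡ p′) ⟩
      p′             ∎

  <⇒≱ : ∀ {a b} → a < b → ¬ b ≤ a
  <⇒≱ (a≤b , a≢b) b≤a = a≢b (antisym a≤b b≤a)

  ≤∧≱⇒< : ∀ {a b} → a ≤ b → ¬ b ≤ a → a < b
  ≤∧≱⇒< a≤b b≰a = a≤b , λ a≡b → b≰a (≤-reflexive (sym a≡b))

  ·-nonneg : ∀ n {a} → 0# ≤ a → 0# ≤ n · a
  ·-nonneg zero    0≤a = ≤-refl
  ·-nonneg (suc n) 0≤a = ≤-trans (≤-reflexive (sym (+-identityʳ 0#))) (+-mono-≤ 0≤a (·-nonneg n 0≤a))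

  inverse-nonneg : ∀ {c t} → 0# ≤ c → c * t ≡ 1# → 0# ≤ t
  inverse-nonneg {c} {t} 0≤c ct≡1 with total 0# t
  ... | inj₁ 0≤t = 0≤t
  ... | inj₂ t≤0 = ⊥-elim (1≰0 (0≤-x⇒x≤0 0≤-1))
    where
    0≤-1 : 0# ≤ - 1#
    0≤-1 = begin
      0#        ≤⟨ *-nonneg 0≤c (x≤0⇒0≤-x t≤0) ⟩
      c * - t   ≡⟨ sym (-‿distribʳ-* c t) ⟩
      - (c * t) ≡⟨ cong -_ ct≡1 ⟩
      - 1#      ∎

  equal-steps : ∀ n {a b} → a < b → ∃[ ε ] (0# < ε × a + suc n · ε ≡ b)
  equal-steps n {a} {b} (a≤b , a≢b) = ε , (0≤ε , 0≢ε) , a+steps≡b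
    where
    d = b - a
    c = suc n · 1#
    c≢0 : c ≢ 0#
    c≢0 c≡0 = 1≰0 (≤-trans (x≤x+y (·-nonneg n 0≤1)) (≤-reflexive c≡0))
    t = proj₁ (inverse c c≢0)
    ct≡1 : c * t ≡ 1#
    ct≡1 = proj₂ (inverse c c≢0)
    ε = t * d
    0≤d : 0# ≤ d
    0≤d = ≤-trans (≤-reflexive (sym (-‿inverseʳ a))) (+-monoˡ-≤ (- a) a≤b)
    0≤ε : 0# ≤ ε
    0≤ε = *-nonneg (inverse-nonneg (·-nonneg (suc n) 0≤1) ct≡1) 0≤d
    c*ε≡d : c * ε ≡ d
    c*ε≡d = begin-equality
      c * (t * d) ≡⟨ sym (*-assoc c t d) ⟩
      (c * t) * d ≡⟨ cong (_* d) ct≡1 ⟩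
      1# * d      ≡⟨ *-identityˡ d ⟩
      d           ∎
    0≢ε : 0# ≢ ε
    0≢ε 0≡ε = a≢b (sym (x∙y⁻¹≈ε⇒x≈y b a d≡0))
      where
      d≡0 : d ≡ 0#
      d≡0 = begin-equality
        d      ≡⟨ sym c*ε≡d ⟩
        c * ε  ≡⟨ cong (c *_) (sym 0≡ε) ⟩
        c * 0# ≡⟨ zeroʳ c ⟩
        0#     ∎
    a+steps≡b : a + suc n · ε ≡ b
    a+steps≡b = begin-equality
      a + suc n · ε        ≡⟨ cong (λ z → a + suc n · z) (sym (*-identityˡ ε)) ⟩
      a + suc n · (1# * ε) ≡⟨ cong (a +_) (sym (×-assoc-* (suc n) 1# ε)) ⟩
      a + c * ε            ≡⟨ cong (a +_) c*ε≡d ⟩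
      a + (b - a)          ≡⟨ +-comm a d ⟩
      (b - a) + a          ≡⟨ //-rightDividesˡ a b ⟩
      b                    ∎

data Form : Set where
  piece : Fin 2 → Fin 2 → Form
  _⊕_   : Form → Form → Form

infixl 6 _⊕_
infix 4 _≼_

size : Form → ℕ
size (piece _ _) = 1
size (f ⊕ g)     = size f +ℕ size g

data Ineq : Set where
  _≼_ : Form → Form → Ineq

a₀ a₁ b₀ b₁ : Form
a₀ = piece 0F 0F
a₁ = piece 0F 1F
b₀ = piece 1F 0F
b₁ = piece 1F 1F

-- ruleA j k (ruleB j k): the conditions under which player A (B) prefers piece j of cake a
-- together with piece k of cake b.
ruleA : Fin 2 → Fin 2 → Ineq × Ineq
ruleA 0F 0F = (a₁ ≼ a₀) , (b₁ ≼ b₀ ⊕ a₁)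
ruleA 0F 1F = (a₁ ≼ a₀) , (b₀ ⊕ a₁ ≼ b₁)
ruleA 1F 0F = (a₀ ≼ a₁) , (b₁ ⊕ a₀ ≼ b₀)
ruleA 1F 1F = (a₀ ≼ a₁) , (b₀ ≼ b₁ ⊕ a₀)

ruleB : Fin 2 → Fin 2 → Ineq × Ineq
ruleB 0F 0F = (b₁ ≼ b₀) , (a₁ ⊕ b₁ ≼ a₀)
ruleB 0F 1F = (b₀ ≼ b₁) , (a₁ ≼ a₀ ⊕ b₀)
ruleB 1F 0F = (b₁ ≼ b₀) , (a₀ ≼ a₁ ⊕ b₁)
ruleB 1F 1F = (b₀ ≼ b₁) , (a₀ ⊕ b₀ ≼ a₁)

≢⇒≡opposite : ∀ {j k : Fin 2} → j ≢ k → k ≡ opposite j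
≢⇒≡opposite {0F} {0F} j≢k = ⊥-elim (j≢k refl)
≢⇒≡opposite {0F} {1F} _   = refl
≢⇒≡opposite {1F} {0F} _   = refl
≢⇒≡opposite {1F} {1F} j≢k = ⊥-elim (j≢k refl)

module _ (R : RealField) where

  open RealField R renaming (+-mono-≤ to +-monoˡ-≤)
  open IsCommutativeRing isCommutativeRing using (+-comm; +-assoc; +-identityʳ; +-identityˡ)
  open RealFieldProperties R
  open import Algebra.Properties.CommutativeSemigroup
    (CommutativeRing.+-commutativeSemigroup commutativeRing) using (interchange)
  open import Relation.Binary.Reasoning.PartialOrder ≤-poset

  ⟦_⟧ : Form → Matrix R → Carrier
  ⟦ piece i j ⟧ x = x i j
  ⟦ f ⊕ g ⟧     x = ⟦ f ⟧ x + ⟦ g ⟧ x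

  Sat : Matrix R → Ineq → Set
  Sat x (l ≼ r) = ⟦ l ⟧ x ≤ ⟦ r ⟧ x

  Holds : Matrix R → Ineq × Ineq → Set
  Holds x (ι , κ) = Sat x ι × Sat x κ

  Close : Carrier → Matrix R → Matrix R → Set
  Close ε y x = ∀ i j → dist< (y i j) (x i j) ε

  ⟦⟧-shift : ∀ {x y ε} → (∀ i j → x i j ≤ y i j + ε) → ∀ f → ⟦ f ⟧ x ≤ ⟦ f ⟧ y + size f · ε
  ⟦⟧-shift {x} {y} {ε} x≤y+ε (piece i j) = begin
    x i j         ≤⟨ x≤y+ε i j ⟩
    y i j + ε     ≡⟨ cong (y i j +_) (sym (+-identityʳ ε)) ⟩
    y i j + 1 · ε ∎
  ⟦⟧-shift {x} {y} {ε} x≤y+ε (f ⊕ g) = begin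
    ⟦ f ⟧ x + ⟦ g ⟧ x                               ≤⟨ +-mono-≤ (⟦⟧-shift x≤y+ε f) (⟦⟧-shift x≤y+ε g) ⟩
    (⟦ f ⟧ y + size f · ε) + (⟦ g ⟧ y + size g · ε) ≡⟨ interchange (⟦ f ⟧ y) _ _ _ ⟩
    (⟦ f ⟧ y + ⟦ g ⟧ y) + (size f · ε + size g · ε) ≡⟨ cong (_ +_) (sym (×-homo-+ ε (size f) (size g))) ⟩
    (⟦ f ⟧ y + ⟦ g ⟧ y) + size (f ⊕ g) · ε          ∎

  -- A strictly violated inequality stays violated nearby: split the gap into more steps
  -- than the inequality has pieces.
  violation-persists : ∀ l r x → ⟦ r ⟧ x < ⟦ l ⟧ x →
    ∃[ ε ] (0# < ε × ∀ y → Close ε y x → ¬ Sat y (l ≼ r))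
  violation-persists l r x r<l with equal-steps (size r +ℕ size l) r<l
  ... | ε , 0<ε , r+steps≡l = ε , 0<ε , λ y y≈x l≤r → <⇒≱ 0<ε (ε≤0 y y≈x l≤r)
    where
    n = size r +ℕ size l
    ε≤0 : ∀ y → Close ε y x → ⟦ l ⟧ y ≤ ⟦ r ⟧ y → ε ≤ 0#
    ε≤0 y y≈x l≤r = +-cancelʳ-≤ (n · ε) (+-cancelˡ-≤ (⟦ r ⟧ x) (begin
      ⟦ r ⟧ x + (ε + n · ε)                ≡⟨ r+steps≡l ⟩
      ⟦ l ⟧ x                              ≤⟨ ⟦⟧-shift (λ i j → sub-≤ (proj₁ (proj₂ (y≈x i j)))) l ⟩
      ⟦ l ⟧ y + size l · ε                 ≤⟨ +-monoˡ-≤ _ l≤r ⟩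
      ⟦ r ⟧ y + size l · ε                 ≤⟨ +-monoˡ-≤ _ (⟦⟧-shift (λ i j → sub-≤ (proj₁ (proj₁ (y≈x i j)))) r) ⟩
      (⟦ r ⟧ x + size r · ε) + size l · ε  ≡⟨ +-assoc (⟦ r ⟧ x) _ _ ⟩
      ⟦ r ⟧ x + (size r · ε + size l · ε)  ≡⟨ cong (⟦ r ⟧ x +_) (sym (×-homo-+ ε (size r) (size l))) ⟩
      ⟦ r ⟧ x + n · ε                      ≡⟨ cong (⟦ r ⟧ x +_) (sym (+-identityˡ (n · ε))) ⟩
      ⟦ r ⟧ x + (0# + n · ε)               ∎))

  violation-persists-⇒ : ∀ {P : Matrix R → Set} l r x → (∀ y → P y → Sat y (l ≼ r)) →
    ⟦ r ⟧ x < ⟦ l ⟧ x → ∃[ ε ] (0# < ε × ∀ y → IsDivision R y → Close ε y x → ¬ P y)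
  violation-persists-⇒ l r x P⇒sat r<l with violation-persists l r x r<l
  ... | ε , 0<ε , unsat = ε , 0<ε , λ y _ y≈x Py → unsat y y≈x (P⇒sat y Py)

  -- If both inequalities fail, they may fail only weakly; their sum then fails strictly.
  Holds-closed : ∀ ικ → IsClosedSet R (λ x → Holds x ικ)
  Holds-closed ((l ≼ r) , (l′ ≼ r′)) x _ ¬holds
    with total (⟦ l ⟧ x) (⟦ r ⟧ x) | total (⟦ l′ ⟧ x) (⟦ r′ ⟧ x)
  ... | inj₁ sat | inj₁ sat′ = ⊥-elim (¬holds (sat , sat′))
  ... | inj₁ sat | inj₂ r′≤l′ =
    violation-persists-⇒ l′ r′ x (λ _ → proj₂) (≤∧≱⇒< r′≤l′ λ sat′ → ¬holds (sat , sat′))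
  ... | inj₂ r≤l | inj₁ sat′ =
    violation-persists-⇒ l r x (λ _ → proj₁) (≤∧≱⇒< r≤l λ sat → ¬holds (sat , sat′))
  ... | inj₂ r≤l | inj₂ r′≤l′ =
    violation-persists-⇒ (l ⊕ l′) (r ⊕ r′) x (λ _ (sat , sat′) → +-mono-≤ sat sat′)
      (≤∧≱⇒< (+-mono-≤ r≤l r′≤l′) λ l+l′≤r+r′ → ¬holds (+-reflect-≤ r≤l r′≤l′ l+l′≤r+r′))

  preferences : (rule : Fin 2 → Fin 2 → Ineq × Ineq) →
    (∀ x → IsDivision R x → ∃[ s ] Holds x (rule (s 0F) (s 1F))) →
    (∀ x → IsDivision R x → ∀ j k → Holds x (rule j k) → ¬ x 0F j ≤ 0# × ¬ x 1F k ≤ 0#) →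
    Preferences R
  preferences rule nonempty hungry = record
    { Pref     = λ x s → Holds x (rule (s 0F) (s 1F))
    ; nonempty = nonempty
    ; hungry   = λ x d s holds → let (j≰0 , k≰0) = hungry x d (s 0F) (s 1F) holds in
        ∀-cons (≤∧≱⇒< (proj₁ d _ _) j≰0) (∀-cons (≤∧≱⇒< (proj₁ d _ _) k≰0) λ ())
    ; closed   = λ s → Holds-closed (rule (s 0F) (s 1F))
    }

  module _ {x : Matrix R} (d : IsDivision R x) where

    row-sum : ∀ i → x i 0F + x i 1F ≡ 1#
    row-sum = proj₂ d

    row-sum′ : ∀ i → x i 1F + x i 0F ≡ 1#
    row-sum′ i = trans (+-comm _ _) (row-sum i)

    nonemptyA : ∃[ s ] Holds x (ruleA (s 0F) (s 1F))
    nonemptyA with total (⟦ a₁ ⟧ x) (⟦ a₀ ⟧ x)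
    ... | inj₁ h with total (⟦ b₁ ⟧ x) (⟦ b₀ ⊕ a₁ ⟧ x)
    ...   | inj₁ g = (0F ∷ 0F ∷ []) , h , g
    ...   | inj₂ g = (0F ∷ 1F ∷ []) , h , g
    nonemptyA | inj₂ h with total (⟦ b₁ ⊕ a₀ ⟧ x) (⟦ b₀ ⟧ x)
    ...   | inj₁ g = (1F ∷ 0F ∷ []) , h , g
    ...   | inj₂ g = (1F ∷ 1F ∷ []) , h , g

    nonemptyB : ∃[ s ] Holds x (ruleB (s 0F) (s 1F))
    nonemptyB with total (⟦ b₁ ⟧ x) (⟦ b₀ ⟧ x)
    ... | inj₁ h with total (⟦ a₁ ⊕ b₁ ⟧ x) (⟦ a₀ ⟧ x)
    ...   | inj₁ g = (0F ∷ 0F ∷ []) , h , g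
    ...   | inj₂ g = (1F ∷ 0F ∷ []) , h , g
    nonemptyB | inj₂ h with total (⟦ a₁ ⟧ x) (⟦ a₀ ⊕ b₀ ⟧ x)
    ...   | inj₁ g = (0F ∷ 1F ∷ []) , h , g
    ...   | inj₂ g = (1F ∷ 1F ∷ []) , h , g

    hungryA : ∀ j k → Holds x (ruleA j k) → ¬ x 0F j ≤ 0# × ¬ x 1F k ≤ 0#
    hungryA 0F 0F (h , g) = major-pos (row-sum 0F) h , boosted-pos (row-sum 0F) (row-sum 1F) h g
    hungryA 0F 1F (h , g) = major-pos (row-sum 0F) h , dominant-pos (row-sum′ 1F) (proj₁ d _ _) g
    hungryA 1F 0F (h , g) = major-pos (row-sum′ 0F) h , dominant-pos (row-sum 1F) (proj₁ d _ _) g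
    hungryA 1F 1F (h , g) = major-pos (row-sum′ 0F) h , boosted-pos (row-sum′ 0F) (row-sum′ 1F) h g

    hungryB : ∀ j k → Holds x (ruleB j k) → ¬ x 0F j ≤ 0# × ¬ x 1F k ≤ 0#
    hungryB 0F 0F (h , g) = dominant-pos (row-sum 0F) (proj₁ d _ _) g , major-pos (row-sum 1F) h
    hungryB 0F 1F (h , g) = boosted-pos (row-sum′ 1F) (row-sum 0F) h g , major-pos (row-sum′ 1F) h
    hungryB 1F 0F (h , g) = boosted-pos (row-sum 1F) (row-sum′ 0F) h g , major-pos (row-sum 1F) h
    hungryB 1F 1F (h , g) = dominant-pos (row-sum′ 0F) (proj₁ d _ _) g , major-pos (row-sum′ 1F) h

    incompatible : ∀ j k → Holds x (ruleA j k) → ¬ Holds x (ruleB (opposite j) (opposite k))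
    incompatible 0F 0F (h , g) (h′ , g′) = boosted-pos (row-sum 0F) (row-sum 1F) h g (x+y≤z≤x⇒y≤0 g′ h)
    incompatible 0F 1F (h , g) (h′ , g′) = boosted-pos (row-sum 1F) (row-sum′ 0F) h′ g′ (x+y≤z≤x⇒y≤0 g h′)
    incompatible 1F 0F (h , g) (h′ , g′) = boosted-pos (row-sum′ 1F) (row-sum 0F) h′ g′ (x+y≤z≤x⇒y≤0 g h′)
    incompatible 1F 1F (h , g) (h′ , g′) = boosted-pos (row-sum′ 0F) (row-sum′ 1F) h g (x+y≤z≤x⇒y≤0 g′ h)

  playerA playerB : Preferences R
  playerA = preferences ruleA (λ _ → nonemptyA) (λ _ → hungryA)
  playerB = preferences ruleB (λ _ → nonemptyB) (λ _ → hungryB)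

theorem3 : (R : RealField) →
    ∃[ A ] ∃[ B ] (¬ (∃[ x ] (IsDivision R x × ∃[ sA ] ∃[ sB ] (Disjoint R sA sB × Preferences.Pref {R} A x sA × Preferences.Pref {R} B x sB))))
theorem3 R = playerA R , playerB R , λ (x , d , sA , sB , disjoint , prefA , prefB) →
  incompatible R d (sA 0F) (sA 1F) prefA
    (subst₂ (λ j k → Holds R x (ruleB j k)) (≢⇒≡opposite (disjoint 0F)) (≢⇒≡opposite (disjoint 1F)) prefB)
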